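{- For any integer $n\geq 4$ and any permutation $\pi$ of $\{1,\dots,n\}$, $\mbox{min-seed}(P_\pi(C_n),2)=\lceil (n+1)/2\rceil$.
   Context: $C_n$ is the $n$-cycle on vertices $x_1,\dots,x_n$ with edges $x_1x_2,\dots,x_{n-1}x_n,x_nx_1$. For a permutation $\pi$ of $\{1,\dots,n\}$, the cycle permutation graph $P_\pi(C_n)$ consists of two disjoint copies of $C_n$, one with vertices $v_1,\dots,v_n$ (edges $v_iv_{i+1}$, $v_nv_1$) and one with vertices $u_1,\dots,u_n$ (edges $u_iu_{i+1}$, $u_nu_1$), together with the $n$ additional edges $v_iu_{\pi(i)}$, $i=1,\dots,n$. For a graph $G$ and positive integer $k$, the activation process in $(G,k)$ starting at $S\subseteq V(G)$: at time $0$ exactly the vertices of $S$ are active; at each subsequent step every inactive vertex with at least $k$ active neighbors becomes active; active vertices stay active; the process stops when nothing changes. $\mbox{min-seed}(G,k)$ is the minimum size of a set $S\subseteq V(G)$ such that at the end of this process all vertices of $G$ are active. -}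

module Defs where

open import Data.Nat using (ℕ; zero; suc; _+_; _≤_; _≤ᵇ_; _≡ᵇ_; _∸_)
open import Data.Bool using (Bool; true; false; _∧_; _∨_; if_then_else_)
open import Data.Fin using (Fin; toℕ; splitAt; _≟_)
open import Data.Fin.Subset using (Subset; ⊤; ∣_∣; inside; outside)
open import Data.Fin.Permutation using (Permutation′; _⟨$⟩ʳ_)
open import Data.Vec using (tabulate; lookup)
open import Data.Sum using (inj₁; inj₂)
open import Data.Product using (Σ; ∃; _×_)
open import Relation.Nullary.Decidable using (⌊_⌋)
open import Relation.Binary.PropositionalEquality using (_≡_)

record Graph (N : ℕ) : Set where
  field
    adj : Fin N → Fin N → Bool
open Graph public

-- Adjacency in the n-cycle on Fin n (0-based: vertex i ~ x_{i+1}):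
-- i ~ j iff j = i+1, i = j+1, or {i,j} = {n-1, 0}.
cycAdj : {n : ℕ} → Fin n → Fin n → Bool
cycAdj {n} i j =
  (suc (toℕ i) ≡ᵇ toℕ j) ∨ (suc (toℕ j) ≡ᵇ toℕ i)
  ∨ ((suc (toℕ i) ≡ᵇ n) ∧ (toℕ j ≡ᵇ 0))
  ∨ ((suc (toℕ j) ≡ᵇ n) ∧ (toℕ i ≡ᵇ 0))

-- Cycle permutation graph P_π(C_n) on Fin (n + n):
-- splitAt n gives inj₁ i = v_i (first copy), inj₂ i = u_i (second copy);
-- extra edges v_i u_{π(i)}.
cyclePermGraph : (n : ℕ) → Permutation′ n → Graph (n + n)
adj (cyclePermGraph n π) a b with splitAt n a | splitAt n b
... | inj₁ i | inj₁ j = cycAdj i j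
... | inj₂ i | inj₂ j = cycAdj i j
... | inj₁ i | inj₂ j = ⌊ (π ⟨$⟩ʳ i) ≟ j ⌋
... | inj₂ i | inj₁ j = ⌊ (π ⟨$⟩ʳ j) ≟ i ⌋

isIn : {N : ℕ} → Subset N → Fin N → Bool
isIn S v with lookup S v
... | inside = true
... | outside = false

fromBool : Bool → _
fromBool true = inside
fromBool false = outside

activeNbrs : {N : ℕ} → Graph N → Subset N → Fin N → ℕ
activeNbrs G S v = ∣ tabulate (λ w → fromBool (adj G v w ∧ isIn S w)) ∣

step : {N : ℕ} → Graph N → ℕ → Subset N → Subset N
step G k S = tabulate (λ v → fromBool (isIn S v ∨ (k ≤ᵇ activeNbrs G S v)))

activeAt : {N : ℕ} → Graph N → ℕ → Subset N → ℕ → Subset N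
activeAt G k S zero = S
activeAt G k S (suc t) = step G k (activeAt G k S t)

-- S activates all vertices (the process is monotone, so "eventually everything
-- is active" is the same as "everything is active when the process stops")
Percolates : {N : ℕ} → Graph N → ℕ → Subset N → Set
Percolates G k S = ∃ λ t → activeAt G k S t ≡ ⊤

MinSeed : {N : ℕ} → Graph N → ℕ → ℕ → Set
MinSeed {N} G k m =
  (Σ (Subset N) λ S → (∣ S ∣ ≡ m) × Percolates G k S)
  × ((S : Subset N) → Percolates G k S → m ≤ ∣ S ∣)

module Submission where

-- Lower bound, valid in every cubic graph G on N ≥ 1 vertices: let S
-- percolate in (G, 2) and label each vertex by its activation time.  For a
-- vertex v let below/above/level be the numbers of its neighbours with
-- smaller/larger/equal time.  Each edge with distinct times is "below" at
-- one end and "above" at the other, so ∑ (2·below + level) = ∑ degree = 3N.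
-- A vertex outside S has below ≥ 2, and a vertex activated last has
-- above = 0, so its summand is below + 3, strictly more than 4·[v ∉ S].
-- Hence 4·(N − |S|) < 3N, i.e. N < 4|S|; as P_π(C_n) is cubic on 2n
-- vertices, |S| ≥ ⌈(n+1)/2⌉.
-- Upper bound: the odd-indexed vertices of the first cycle together with the
-- partner of its vertex 0 percolate (module Seeding).

open import Defs
open import Data.Nat using (ℕ; zero; suc; _+_; _*_; _∸_; _≤_; _<_; _≡ᵇ_; _<ᵇ_; _≤ᵇ_; z≤n; s≤s; s≤s⁻¹; ⌈_/2⌉; ⌊_/2⌋)
open import Data.Nat.Properties
open import Data.Bool using (Bool; true; false; not; _∧_; _∨_; T; if_then_else_)
open import Data.Bool.Properties using (T-≡; ∨-zeroʳ; ∨-comm; ∧-zeroʳ)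
open import Data.Fin as Fin using (Fin; toℕ; _↑ˡ_; _↑ʳ_; splitAt)
open import Data.Fin.Properties as FinP
  using (toℕ<n; toℕ-fromℕ<; toℕ-fromℕ; toℕ-inject₁; toℕ-injective; ↑ˡ-injective; splitAt-↑ˡ; splitAt-↑ʳ; join-splitAt)
open import Data.Fin.Subset using (Subset; ∣_∣; ⊤)
open import Data.Fin.Subset.Properties using (∣p∣≡n⇒p≡⊤)
open import Data.Fin.Permutation using (Permutation′; _⟨$⟩ʳ_; _⟨$⟩ˡ_; inverseˡ; inverseʳ)
open import Data.Vec using ([]; _∷_; lookup; tabulate)
open import Data.Vec.Properties using (lookup∘tabulate; lookup-replicate)
open import Data.Empty using (⊥)
open import Data.Sum using (_⊎_; inj₁; inj₂; [_,_]′)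
open import Data.Product using (∃; _×_; _,_)
open import Function using (_∘_; Equivalence)
open import Relation.Nullary using (yes; no; contradiction)
open import Relation.Nullary.Decidable using (⌊_⌋; isYes≗does; dec-true; dec-false; toWitness)
open import Relation.Binary.PropositionalEquality
open import Data.Nat.Tactic.RingSolver using (solve-∀)
open import Algebra.Properties.Semiring.Sum +-*-semiring
  using (sum; sum-syntax; sum-cong-≗; ∑-distrib-+; ∑-comm; *-distribˡ-sum)

T⇒≡true : ∀ {b} → T b → b ≡ true
T⇒≡true = Equivalence.to T-≡

≡true⇒T : ∀ {b} → b ≡ true → T b
≡true⇒T = Equivalence.from T-≡

𝟙 : Bool → ℕ
𝟙 true = 1
𝟙 false = 0

count : ∀ {m} → (Fin m → Bool) → ℕ
count f = sum (𝟙 ∘ f)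

sum-mono : ∀ {m} {f g : Fin m → ℕ} → (∀ x → f x ≤ g x) → sum f ≤ sum g
sum-mono {zero} le = z≤n
sum-mono {suc m} le = +-mono-≤ (le Fin.zero) (sum-mono (le ∘ Fin.suc))

sum-strict : ∀ {m} {f g : Fin m → ℕ} → (∀ x → f x ≤ g x) →
  (a : Fin m) → f a < g a → sum f < sum g
sum-strict le Fin.zero lt = +-mono-<-≤ lt (sum-mono (le ∘ Fin.suc))
sum-strict le (Fin.suc a) lt = +-mono-≤-< (le Fin.zero) (sum-strict (le ∘ Fin.suc) a lt)

sum-↑ : ∀ m {n} (f : Fin (m + n) → ℕ) →
  sum f ≡ sum (f ∘ (_↑ˡ n)) + sum (f ∘ (m ↑ʳ_))
sum-↑ zero f = refl
sum-↑ (suc m) f = trans (cong (f Fin.zero +_) (sum-↑ m (f ∘ Fin.suc))) (sym (+-assoc (f Fin.zero) _ _))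

count-cong : ∀ {m} {f g : Fin m → Bool} → (∀ x → f x ≡ g x) → count f ≡ count g
count-cong e = sum-cong-≗ (cong 𝟙 ∘ e)

count-mono : ∀ {m} {f g : Fin m → Bool} → (∀ x → f x ≡ true → g x ≡ true) → count f ≤ count g
count-mono {f = f} {g} inc = sum-mono pointwise
  where
  pointwise : ∀ x → 𝟙 (f x) ≤ 𝟙 (g x)
  pointwise x with f x in fx
  ... | false = z≤n
  ... | true rewrite inc x fx = ≤-refl

count-true : ∀ {m} (f : Fin m → Bool) → (∀ x → f x ≡ true) → count f ≡ m
count-true {zero} f all = refl
count-true {suc m} f all rewrite all Fin.zero = cong suc (count-true (f ∘ Fin.suc) (all ∘ Fin.suc))

count-complement : ∀ {m} (f : Fin m → Bool) → count f + count (not ∘ f) ≡ m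
count-complement {m} f = begin
  count f + count (not ∘ f)           ≡⟨ ∑-distrib-+ (𝟙 ∘ f) (𝟙 ∘ not ∘ f) ⟨
  sum (λ x → 𝟙 (f x) + 𝟙 (not (f x))) ≡⟨ sum-cong-≗ (λ x → one (f x)) ⟩
  count {m} (λ _ → true)              ≡⟨ count-true (λ _ → true) (λ _ → refl) ⟩
  m                                   ∎
  where
  open ≡-Reasoning
  one : ∀ b → 𝟙 b + 𝟙 (not b) ≡ 1
  one true = refl
  one false = refl

count-∨ : ∀ {m} (f g : Fin m → Bool) → (∀ x → f x ≡ true → g x ≡ false) →
  count (λ x → f x ∨ g x) ≡ count f + count g
count-∨ f g disjoint = trans (sum-cong-≗ pointwise) (∑-distrib-+ (𝟙 ∘ f) (𝟙 ∘ g))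
  where
  pointwise : ∀ x → 𝟙 (f x ∨ g x) ≡ 𝟙 (f x) + 𝟙 (g x)
  pointwise x with f x in fx
  ... | true rewrite disjoint x fx = refl
  ... | false = refl

count-false : ∀ {m} (f : Fin m → Bool) → (∀ x → f x ≡ false) → count f ≡ 0
count-false {zero} f none = refl
count-false {suc m} f none rewrite none Fin.zero = count-false (f ∘ Fin.suc) (none ∘ Fin.suc)

count-unique : ∀ {m} (f : Fin m → Bool) (a : Fin m) → f a ≡ true →
  (∀ x → f x ≡ true → x ≡ a) → count f ≡ 1
count-unique {suc m} f Fin.zero fa only rewrite fa =
  cong suc (count-false (f ∘ Fin.suc) elsewhere)
  where
  elsewhere : ∀ x → f (Fin.suc x) ≡ false
  elsewhere x with f (Fin.suc x) in fx
  ... | false = refl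
  ... | true with only (Fin.suc x) fx
  ... | ()
count-unique {suc m} f (Fin.suc a) fa only with f Fin.zero in f0
... | true with only Fin.zero f0
... | ()
count-unique {suc m} f (Fin.suc a) fa only | false =
  count-unique (f ∘ Fin.suc) a fa (λ x fx → FinP.suc-injective (only (Fin.suc x) fx))

≟-refl : ∀ {m} (a : Fin m) → ⌊ a Fin.≟ a ⌋ ≡ true
≟-refl a = trans (isYes≗does (a Fin.≟ a)) (dec-true (a Fin.≟ a) refl)

≟-sound : ∀ {m} {x a : Fin m} → ⌊ x Fin.≟ a ⌋ ≡ true → x ≡ a
≟-sound e = toWitness (≡true⇒T e)

count≥2 : ∀ {m} (f : Fin m → Bool) (a b : Fin m) → a ≢ b →
  f a ≡ true → f b ≡ true → 2 ≤ count f
count≥2 f a b a≢b fa fb = begin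
  2                               ≡⟨ cong₂ _+_ (exactly a) (exactly b) ⟨
  count (is a) + count (is b)     ≡⟨ count-∨ (is a) (is b) disjoint ⟨
  count (λ x → is a x ∨ is b x)   ≤⟨ count-mono inside ⟩
  count f                         ∎
  where
  open ≤-Reasoning
  is : Fin _ → Fin _ → Bool
  is c x = ⌊ x Fin.≟ c ⌋
  exactly : ∀ c → count (is c) ≡ 1
  exactly c = count-unique (is c) c (≟-refl c) (λ x → ≟-sound)
  disjoint : ∀ x → is a x ≡ true → is b x ≡ false
  disjoint x x≡a = trans (isYes≗does (x Fin.≟ b)) (dec-false (x Fin.≟ b) (λ x≡b → a≢b (trans (sym (≟-sound x≡a)) x≡b)))
  inside : ∀ x → (is a x ∨ is b x) ≡ true → f x ≡ true
  inside x e with x Fin.≟ a | x Fin.≟ b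
  ... | yes refl | _ = fa
  ... | no _ | yes refl = fb

isIn≡lookup : ∀ {N} (X : Subset N) v → isIn X v ≡ lookup X v
isIn≡lookup X v with lookup X v
... | true = refl
... | false = refl

isIn-tabulate : ∀ {N} (f : Fin N → Bool) v → isIn (tabulate (fromBool ∘ f)) v ≡ f v
isIn-tabulate f v = begin
  isIn (tabulate (fromBool ∘ f)) v   ≡⟨ isIn≡lookup (tabulate (fromBool ∘ f)) v ⟩
  lookup (tabulate (fromBool ∘ f)) v ≡⟨ lookup∘tabulate (fromBool ∘ f) v ⟩
  fromBool (f v)                     ≡⟨ fromBool-id (f v) ⟩
  f v                                ∎
  where
  open ≡-Reasoning
  fromBool-id : ∀ b → fromBool b ≡ b
  fromBool-id true = refl
  fromBool-id false = refl

∣∣≡count : ∀ {N} (X : Subset N) → ∣ X ∣ ≡ count (isIn X)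
∣∣≡count [] = refl
∣∣≡count (true ∷ X) = cong suc (∣∣≡count X)
∣∣≡count (false ∷ X) = ∣∣≡count X

∣tabulate∣ : ∀ {N} (f : Fin N → Bool) → ∣ tabulate (fromBool ∘ f) ∣ ≡ count f
∣tabulate∣ f = trans (∣∣≡count (tabulate (fromBool ∘ f))) (count-cong (isIn-tabulate f))

all-in⇒⊤ : ∀ {N} (X : Subset N) → (∀ v → isIn X v ≡ true) → X ≡ ⊤
all-in⇒⊤ X all = ∣p∣≡n⇒p≡⊤ (trans (∣∣≡count X) (count-true (isIn X) all))

degree : ∀ {N} → Graph N → Fin N → ℕ
degree G v = count (adj G v)

Symmetric : ∀ {N} → Graph N → Set
Symmetric G = ∀ v w → adj G v w ≡ adj G w v

Cubic : ∀ {N} → Graph N → Set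
Cubic G = ∀ v → degree G v ≡ 3

module Activation {N} (G : Graph N) (k : ℕ) where

  activeNbrs≡count : ∀ X v → activeNbrs G X v ≡ count (λ w → adj G v w ∧ isIn X w)
  activeNbrs≡count X v = ∣tabulate∣ (λ w → adj G v w ∧ isIn X w)

  step-spec : ∀ X v → isIn (step G k X) v ≡ (isIn X v ∨ (k ≤ᵇ activeNbrs G X v))
  step-spec X v = isIn-tabulate (λ v → isIn X v ∨ (k ≤ᵇ activeNbrs G X v)) v

  step-keeps : ∀ X v → isIn X v ≡ true → isIn (step G k X) v ≡ true
  step-keeps X v act rewrite step-spec X v | act = refl

  step-activates : ∀ X v → k ≤ count (λ w → adj G v w ∧ isIn X w) → isIn (step G k X) v ≡ true
  step-activates X v enough
    rewrite step-spec X v | activeNbrs≡count X v | T⇒≡true (≤⇒≤ᵇ enough) = ∨-zeroʳ (isIn X v)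

  step-new : ∀ X v → isIn (step G k X) v ≡ true → isIn X v ≡ false →
    k ≤ count (λ w → adj G v w ∧ isIn X w)
  step-new X v now before rewrite step-spec X v | before | activeNbrs≡count X v =
    ≤ᵇ⇒≤ k _ (≡true⇒T now)

  activeAt-mono : ∀ S {i j} v → i ≤ j → isIn (activeAt G k S i) v ≡ true →
    isIn (activeAt G k S j) v ≡ true
  activeAt-mono S {j = zero} v z≤n act = act
  activeAt-mono S {i} {suc j} v i≤j act with m≤n⇒m<n∨m≡n i≤j
  ... | inj₁ i<1+j = step-keeps (activeAt G k S j) v (activeAt-mono S v (s≤s⁻¹ i<1+j) act)
  ... | inj₂ refl = act

activate-by-two : ∀ {N} (G : Graph N) X v a b → a ≢ b →
  adj G v a ≡ true → adj G v b ≡ true → isIn X a ≡ true → isIn X b ≡ true →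
  isIn (step G 2 X) v ≡ true
activate-by-two G X v a b a≢b va vb Xa Xb =
  Activation.step-activates G 2 X v (count≥2 _ a b a≢b (cong₂ _∧_ va Xa) (cong₂ _∧_ vb Xb))

maximiser : ∀ {N} (f : Fin (suc N) → ℕ) → ∃ λ z → ∀ v → f v ≤ f z
maximiser {zero} f = Fin.zero , λ { Fin.zero → ≤-refl }
maximiser {suc N} f with maximiser (f ∘ Fin.suc)
... | z , max with f Fin.zero ≤? f (Fin.suc z)
... | yes ≤z = Fin.suc z , λ { Fin.zero → ≤z ; (Fin.suc v) → max v }
... | no ≰z = Fin.zero , λ { Fin.zero → ≤-refl ; (Fin.suc v) → ≤-trans (max v) (≰⇒≥ ≰z) }

-- The least t ≤ b satisfying p (b itself if there is none).
least : (ℕ → Bool) → ℕ → ℕ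
least p zero = zero
least p (suc b) = if p zero then zero else suc (least (p ∘ suc) b)

least-satisfies : ∀ (p : ℕ → Bool) b t → t ≤ b → p t ≡ true → p (least p b) ≡ true
least-satisfies p zero zero z≤n pt = pt
least-satisfies p (suc b) t t≤b pt with p zero in p0
... | true = p0
least-satisfies p (suc b) zero t≤b pt | false = contradiction (trans (sym p0) pt) λ ()
least-satisfies p (suc b) (suc t) t≤b pt | false = least-satisfies (p ∘ suc) b t (s≤s⁻¹ t≤b) pt

least-minimal : ∀ (p : ℕ → Bool) b t → t < least p b → p t ≡ false
least-minimal p (suc b) t t<least with p zero in p0
least-minimal p (suc b) zero t<least | false = p0
least-minimal p (suc b) (suc t) t<least | false = least-minimal (p ∘ suc) b t (s≤s⁻¹ t<least)

least-≤ : ∀ (p : ℕ → Bool) b t → p t ≡ true → least p b ≤ t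
least-≤ p b t pt = ≮⇒≥ (λ t<least → contradiction (trans (sym pt) (least-minimal p b t t<least)) λ ())

∑-distrib-+₃ : ∀ {m} (f g h : Fin m → ℕ) →
  sum (λ x → f x + g x + h x) ≡ sum f + sum g + sum h
∑-distrib-+₃ f g h = trans (∑-distrib-+ (λ x → f x + g x) h) (cong (_+ sum h) (∑-distrib-+ f g))

module EdgeLabels {N} (G : Graph N) (label : Fin N → ℕ) where

  below above level : Fin N → ℕ
  below v = count (λ w → adj G v w ∧ (label w <ᵇ label v))
  above v = count (λ w → adj G v w ∧ (label v <ᵇ label w))
  level v = count (λ w → adj G v w ∧ (label w ≡ᵇ label v))

  degree-split : ∀ v → degree G v ≡ below v + above v + level v
  degree-split v = trans (sum-cong-≗ (λ w → trichotomy (adj G v w) (label w) (label v)))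
                         (∑-distrib-+₃ (λ w → 𝟙 (adj G v w ∧ (label w <ᵇ label v)))
                                       (λ w → 𝟙 (adj G v w ∧ (label v <ᵇ label w)))
                                       (λ w → 𝟙 (adj G v w ∧ (label w ≡ᵇ label v))))
    where
    trichotomy : ∀ a x y → 𝟙 a ≡ 𝟙 (a ∧ (x <ᵇ y)) + 𝟙 (a ∧ (y <ᵇ x)) + 𝟙 (a ∧ (x ≡ᵇ y))
    trichotomy false x y = refl
    trichotomy true zero zero = refl
    trichotomy true zero (suc y) = refl
    trichotomy true (suc x) zero = refl
    trichotomy true (suc x) (suc y) = trichotomy true x y

  -- In a symmetric graph every edge with distinct labels is counted once
  -- from its lower and once from its upper end.
  below-above-balance : Symmetric G → sum below ≡ sum above
  below-above-balance symmetric = begin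
    ∑[ v < N ] ∑[ w < N ] 𝟙 (adj G v w ∧ (label w <ᵇ label v)) ≡⟨ ∑-comm (λ v w → 𝟙 (adj G v w ∧ (label w <ᵇ label v))) ⟩
    ∑[ w < N ] ∑[ v < N ] 𝟙 (adj G v w ∧ (label w <ᵇ label v))
      ≡⟨ sum-cong-≗ (λ w → sum-cong-≗ (λ v → cong (λ e → 𝟙 (e ∧ (label w <ᵇ label v))) (symmetric v w))) ⟩
    ∑[ w < N ] ∑[ v < N ] 𝟙 (adj G w v ∧ (label w <ᵇ label v)) ∎
    where open ≡-Reasoning

  weighted-degree-sum : Symmetric G → sum (λ v → 2 * below v + level v) ≡ sum (degree G)
  weighted-degree-sum symmetric = begin
    sum (λ v → 2 * below v + level v)         ≡⟨ sum-cong-≗ (λ v → cong (_+ level v) (cong (below v +_) (+-identityʳ (below v)))) ⟩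
    sum (λ v → below v + below v + level v)   ≡⟨ ∑-distrib-+₃ below below level ⟩
    sum below + sum below + sum level         ≡⟨ cong (λ s → sum below + s + sum level) (below-above-balance symmetric) ⟩
    sum below + sum above + sum level         ≡⟨ ∑-distrib-+₃ below above level ⟨
    sum (λ v → below v + above v + level v)   ≡⟨ sum-cong-≗ degree-split ⟨
    sum (degree G)                            ∎
    where open ≡-Reasoning

module CubicLowerBound {N} (G : Graph (suc N)) (symmetric : Symmetric G) (cubic : Cubic G)
                       (S : Subset (suc N)) (T : ℕ) (done : activeAt G 2 S T ≡ ⊤) where

  open Activation G 2

  active : ℕ → Fin (suc N) → Bool
  active t v = isIn (activeAt G 2 S t) v

  active-at-T : ∀ v → active T v ≡ true
  active-at-T v rewrite done = trans (isIn≡lookup ⊤ v) (lookup-replicate v true)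

  time : Fin (suc N) → ℕ
  time v = least (λ t → active t v) T

  active⇒time≤ : ∀ {t} v → active t v ≡ true → time v ≤ t
  active⇒time≤ {t} v = least-≤ (λ t → active t v) T t

  time≤⇒active : ∀ {t} v → time v ≤ t → active t v ≡ true
  time≤⇒active {t} v time≤t = activeAt-mono S {time v} {t} v time≤t
    (least-satisfies (λ t → active t v) T T ≤-refl (active-at-T v))

  open EdgeLabels G time

  non-seed-below : ∀ v → isIn S v ≡ false → 2 ≤ below v
  non-seed-below v v∉S = from-time (time v) refl
    where
    from-time : ∀ s → time v ≡ s → 2 ≤ below v
    from-time zero time≡ =
      contradiction (trans (sym v∉S) (time≤⇒active v (≤-reflexive time≡))) λ ()
    from-time (suc t) time≡ = begin
      2                                           ≤⟨ step-new (activeAt G 2 S t) v now before ⟩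
      count (λ w → adj G v w ∧ active t w)        ≤⟨ count-mono earlier ⟩
      count (λ w → adj G v w ∧ (time w <ᵇ suc t)) ≡⟨ count-cong (λ w → cong (λ s → adj G v w ∧ (time w <ᵇ s)) time≡) ⟨
      below v                                     ∎
      where
      open ≤-Reasoning
      now : active (suc t) v ≡ true
      now = time≤⇒active v (≤-reflexive time≡)
      before : active t v ≡ false
      before = least-minimal (λ t → active t v) T t (≤-reflexive (sym time≡))
      earlier : ∀ w → (adj G v w ∧ active t w) ≡ true → (adj G v w ∧ (time w <ᵇ suc t)) ≡ true
      earlier w vw∧act with adj G v w
      ... | true = T⇒≡true (<⇒<ᵇ (s≤s (active⇒time≤ w vw∧act)))

  weight : ∀ v → 4 * 𝟙 (not (isIn S v)) ≤ 2 * below v + level v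
  weight v with isIn S v in v∈S
  ... | true = z≤n
  ... | false = ≤-trans (*-monoʳ-≤ 2 (non-seed-below v v∈S)) (m≤m+n _ _)

  -- ... and a vertex activated last weighs strictly more, as it has
  -- no later neighbours and so all 3 of its neighbours count.
  weight-last : ∀ z → (∀ v → time v ≤ time z) → 4 * 𝟙 (not (isIn S z)) < 2 * below z + level z
  weight-last z last = subst (4 * 𝟙 (not (isIn S z)) <_) weight≡ (bound (isIn S z) refl)
    where
    nothing-above : above z ≡ 0
    nothing-above = count-false _ none
      where
      none : ∀ w → (adj G z w ∧ (time z <ᵇ time w)) ≡ false
      none w with time z <ᵇ time w in later
      ... | false = ∧-zeroʳ (adj G z w)
      ... | true = contradiction (<ᵇ⇒< _ _ (≡true⇒T later)) (≤⇒≯ (last w))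
    weight≡ : below z + 3 ≡ 2 * below z + level z
    weight≡ = begin
      below z + 3                                   ≡⟨ cong (below z +_) (trans (sym (cubic z)) (degree-split z)) ⟩
      below z + (below z + above z + level z)       ≡⟨ cong (λ a → below z + (below z + a + level z)) nothing-above ⟩
      below z + (below z + 0 + level z)             ≡⟨ +-assoc (below z) (below z + 0) (level z) ⟨
      2 * below z + level z                         ∎
      where open ≡-Reasoning
    bound : ∀ b → isIn S z ≡ b → 4 * 𝟙 (not b) < below z + 3
    bound true _ = ≤-trans (s≤s z≤n) (m≤n+m 3 (below z))
    bound false z∉S = +-monoˡ-≤ 3 (non-seed-below z z∉S)

  non-seeds-bound : 4 * count (not ∘ isIn S) < 3 * suc N
  non-seeds-bound with maximiser time
  ... | z , last = begin-strict
    4 * count (not ∘ isIn S)               ≡⟨ *-distribˡ-sum 4 (𝟙 ∘ not ∘ isIn S) ⟩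
    sum (λ v → 4 * 𝟙 (not (isIn S v)))     <⟨ sum-strict weight z (weight-last z last) ⟩
    sum (λ v → 2 * below v + level v)      ≡⟨ weighted-degree-sum symmetric ⟩
    sum (degree G)                         ≡⟨ sum-cong-≗ {suc N} cubic ⟩
    sum {suc N} (λ _ → 3 * 1)              ≡⟨ *-distribˡ-sum {suc N} 3 (λ _ → 1) ⟨
    3 * count {suc N} (λ _ → true)         ≡⟨ cong (3 *_) (count-true {suc N} (λ _ → true) (λ _ → refl)) ⟩
    3 * suc N                              ∎
    where open ≤-Reasoning

quarter : ∀ {M s c} → s + c ≡ M → 4 * c < 3 * M → M < 4 * s
quarter {s = s} {c} refl 4c<3M = +-cancelʳ-< (3 * (s + c)) (s + c) (4 * s) (begin-strict
  s + c + 3 * (s + c) ≡⟨ expand s c ⟩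
  4 * s + 4 * c       <⟨ +-monoʳ-< (4 * s) 4c<3M ⟩
  4 * s + 3 * (s + c) ∎)
  where
  open ≤-Reasoning
  expand : ∀ s c → s + c + 3 * (s + c) ≡ 4 * s + 4 * c
  expand = solve-∀

cubic-seed-bound : ∀ {N} (G : Graph (suc N)) → Symmetric G → Cubic G →
  ∀ S → Percolates G 2 S → suc N < 4 * ∣ S ∣
cubic-seed-bound {N} G symmetric cubic S (T , done) =
  quarter {suc N} {∣ S ∣} {count (not ∘ isIn S)} split
    (CubicLowerBound.non-seeds-bound G symmetric cubic S T done)
  where
  split : ∣ S ∣ + count (not ∘ isIn S) ≡ suc N
  split = trans (cong (_+ count (not ∘ isIn S)) (∣∣≡count S)) (count-complement (isIn S))

data Follows {n} (i j : Fin n) : Set where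
  succ : suc (toℕ i) ≡ toℕ j → Follows i j
  wrap : suc (toℕ i) ≡ n → toℕ j ≡ 0 → Follows i j

follows : ∀ {n} → Fin n → Fin n → Bool
follows {n} i j = (suc (toℕ i) ≡ᵇ toℕ j) ∨ ((suc (toℕ i) ≡ᵇ n) ∧ (toℕ j ≡ᵇ 0))

follows⇒Follows : ∀ {n} (i j : Fin n) → follows i j ≡ true → Follows i j
follows⇒Follows {n} i j h with suc (toℕ i) ≡ᵇ toℕ j in e₁
... | true = succ (≡ᵇ⇒≡ _ _ (≡true⇒T e₁))
... | false with suc (toℕ i) ≡ᵇ n in e₂ | toℕ j ≡ᵇ 0 in e₃
... | true | true = wrap (≡ᵇ⇒≡ _ _ (≡true⇒T e₂)) (≡ᵇ⇒≡ _ _ (≡true⇒T e₃))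
follows⇒Follows i j () | false | true | false
follows⇒Follows i j () | false | false | _

Follows⇒follows : ∀ {n} {i j : Fin n} → Follows i j → follows i j ≡ true
Follows⇒follows (succ e) rewrite T⇒≡true (≡⇒≡ᵇ _ _ e) = refl
Follows⇒follows {n} {i} {j} (wrap e z)
  rewrite T⇒≡true (≡⇒≡ᵇ _ _ e) | T⇒≡true (≡⇒≡ᵇ _ _ z) = ∨-zeroʳ _

cycAdj≡follows : ∀ {n} (i j : Fin n) → cycAdj i j ≡ (follows i j ∨ follows j i)
cycAdj≡follows {n} i j = interchange (suc (toℕ i) ≡ᵇ toℕ j) (suc (toℕ j) ≡ᵇ toℕ i)
                                     ((suc (toℕ i) ≡ᵇ n) ∧ (toℕ j ≡ᵇ 0))
                                     ((suc (toℕ j) ≡ᵇ n) ∧ (toℕ i ≡ᵇ 0))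
  where
  interchange : ∀ a b c d → (a ∨ (b ∨ (c ∨ d))) ≡ ((a ∨ c) ∨ (b ∨ d))
  interchange true b c d = refl
  interchange false true c d = sym (∨-zeroʳ c)
  interchange false false c d = refl

Follows⇒cycAdj : ∀ {n} {i j : Fin n} → Follows i j → cycAdj i j ≡ true
Follows⇒cycAdj {i = i} {j} f rewrite cycAdj≡follows i j | Follows⇒follows f = refl

Follows⇒cycAdj⁻ : ∀ {n} {i j : Fin n} → Follows i j → cycAdj j i ≡ true
Follows⇒cycAdj⁻ {i = i} {j} f rewrite cycAdj≡follows j i | Follows⇒follows f = ∨-zeroʳ _

successor : ∀ {n} (i : Fin n) → ∃ λ j → Follows i j
successor {n} i with m≤n⇒m<n∨m≡n (toℕ<n i)
... | inj₁ 1+i<n = Fin.fromℕ< 1+i<n , succ (sym (toℕ-fromℕ< 1+i<n))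
... | inj₂ 1+i≡n = Fin.fromℕ< 0<n , wrap 1+i≡n (toℕ-fromℕ< 0<n)
  where
  0<n : 0 < n
  0<n = ≤-trans (s≤s z≤n) (toℕ<n i)

predecessor : ∀ {n} (j : Fin n) → ∃ λ i → Follows i j
predecessor {suc m} Fin.zero = Fin.fromℕ m , wrap (cong suc (toℕ-fromℕ m)) refl
predecessor (Fin.suc k) = Fin.inject₁ k , succ (cong suc (toℕ-inject₁ k))

successor-unique : ∀ {n} {i j j′ : Fin n} → Follows i j → Follows i j′ → j ≡ j′
successor-unique (succ e) (succ e′) = toℕ-injective (trans (sym e) e′)
successor-unique {j = j} (succ e) (wrap e′ _) = contradiction (trans (sym e′) e) (<⇒≢ (toℕ<n j) ∘ sym)
successor-unique {j′ = j′} (wrap e _) (succ e′) = contradiction (trans (sym e) e′) (<⇒≢ (toℕ<n j′) ∘ sym)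
successor-unique (wrap _ z) (wrap _ z′) = toℕ-injective (trans z (sym z′))

predecessor-unique : ∀ {n} {i i′ j : Fin n} → Follows i j → Follows i′ j → i ≡ i′
predecessor-unique (succ e) (succ e′) = toℕ-injective (suc-injective (trans e (sym e′)))
predecessor-unique (succ e) (wrap _ z) = contradiction (trans e z) λ ()
predecessor-unique (wrap _ z) (succ e′) = contradiction (trans e′ z) λ ()
predecessor-unique (wrap e _) (wrap e′ _) = toℕ-injective (suc-injective (trans e (sym e′)))

follows-asymmetric : ∀ {n} → 3 ≤ n → {i j : Fin n} → Follows i j → Follows j i → ⊥
follows-asymmetric n≥3 (succ e) (succ e′) =
  <-irrefl (sym (trans (cong suc e) e′)) (m<n⇒m<1+n (n<1+n _))
follows-asymmetric n≥3 (succ e) (wrap e′ z′) =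
  <⇒≢ n≥3 (trans (cong (suc ∘ suc) (sym z′)) (trans (cong suc e) e′))
follows-asymmetric n≥3 (wrap e z) (succ e′) =
  <⇒≢ n≥3 (trans (cong (suc ∘ suc) (sym z)) (trans (cong suc e′) e))
follows-asymmetric n≥3 (wrap e z) (wrap e′ z′) =
  <⇒≢ (≤-trans (s≤s (s≤s z≤n)) n≥3) (trans (cong suc (sym z)) e′)

cycle-degree : ∀ {n} → 3 ≤ n → (i : Fin n) → count (cycAdj i) ≡ 2
cycle-degree n≥3 i = begin
  count (cycAdj i)                              ≡⟨ count-cong (cycAdj≡follows i) ⟩
  count (λ x → follows i x ∨ follows x i)       ≡⟨ count-∨ (follows i) (λ x → follows x i) disjoint ⟩
  count (follows i) + count (λ x → follows x i) ≡⟨ cong₂ _+_ one-successor one-predecessor ⟩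
  2                                             ∎
  where
  open ≡-Reasoning
  one-successor : count (follows i) ≡ 1
  one-successor with successor i
  ... | j , i→j = count-unique (follows i) j (Follows⇒follows i→j)
    (λ x fx → successor-unique (follows⇒Follows i x fx) i→j)
  one-predecessor : count (λ x → follows x i) ≡ 1
  one-predecessor with predecessor i
  ... | j , j→i = count-unique (λ x → follows x i) j (Follows⇒follows j→i)
    (λ x fx → predecessor-unique (follows⇒Follows x i fx) j→i)
  disjoint : ∀ x → follows i x ≡ true → follows x i ≡ false
  disjoint x fx with follows x i in fx′
  ... | false = refl
  ... | true = contradiction (follows⇒Follows x i fx′)
                 (follows-asymmetric n≥3 (follows⇒Follows i x fx))

wrap-around : ∀ {n} → Fin n → ∃ λ (ℓ : Fin n) → ∃ λ (z : Fin n) → suc (toℕ ℓ) ≡ n × toℕ z ≡ 0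
wrap-around {suc m} _ = Fin.fromℕ m , Fin.zero , cong suc (toℕ-fromℕ m) , refl

module CycleSpread {n} (P : ℕ → Fin n → Set)
  (persist : ∀ {t} i → P t i → P (suc t) i)
  (spread : ∀ {t} i j → cycAdj i j ≡ true → P t j → P (suc t) i) where

  later : ∀ {s t} i → s ≤ t → P s i → P t i
  later {s} {t} i s≤t Ps with m≤n⇒m<n∨m≡n s≤t
  ... | inj₂ refl = Ps
  later {s} {suc t} i s≤t Ps | inj₁ s<1+t = persist i (later i (s≤s⁻¹ s<1+t) Ps)

  forward : ∀ {t} a d j → toℕ j ≡ toℕ a + d → P t a → P (t + d) j
  forward {t} a zero j j≡a Pa
    rewrite +-identityʳ t | toℕ-injective (trans j≡a (+-identityʳ (toℕ a))) = Pa
  forward {t} a (suc d) j j≡a+1+d Pa with predecessor j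
  ... | i , wrap _ j≡0 = contradiction (trans (sym j≡0) (trans j≡a+1+d (+-suc (toℕ a) d))) λ ()
  ... | i , succ 1+i≡j = subst (λ s → P s j) (sym (+-suc t d))
    (spread j i (Follows⇒cycAdj⁻ (succ 1+i≡j))
      (forward a d i (suc-injective (trans 1+i≡j (trans j≡a+1+d (+-suc (toℕ a) d)))) Pa))

  -- From a go forward to the last vertex ℓ, across to vertex 0, forward to j.
  all-active : ∀ {t} a → P t a → ∀ j → P (t + (n + n)) j
  all-active {t} a Pa j with wrap-around a
  ... | ℓ , z , 1+ℓ≡n , z≡0 =
    later j (≤-trans (≤-reflexive regroup) (+-monoʳ-≤ t bound))
      (forward z (toℕ j) j (cong (_+ toℕ j) (sym z≡0))
        (spread z ℓ (Follows⇒cycAdj⁻ (wrap 1+ℓ≡n z≡0)) (forward a d ℓ ℓ≡a+d Pa)))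
    where
    d : ℕ
    d = toℕ ℓ ∸ toℕ a
    ℓ≡a+d : toℕ ℓ ≡ toℕ a + d
    ℓ≡a+d = sym (m+[n∸m]≡n (s≤s⁻¹ (subst (toℕ a <_) (sym 1+ℓ≡n) (toℕ<n a))))
    regroup : suc (t + d) + toℕ j ≡ t + (suc d + toℕ j)
    regroup = trans (cong suc (+-assoc t d (toℕ j))) (sym (+-suc t (d + toℕ j)))
    bound : suc d + toℕ j ≤ n + n
    bound = +-mono-≤ (subst (suc d ≤_) 1+ℓ≡n (s≤s (m∸n≤m (toℕ ℓ) (toℕ a)))) (<⇒≤ (toℕ<n j))

cycAdj-sym : ∀ {n} (i j : Fin n) → cycAdj i j ≡ cycAdj j i
cycAdj-sym i j = begin
  cycAdj i j                ≡⟨ cycAdj≡follows i j ⟩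
  follows i j ∨ follows j i ≡⟨ ∨-comm (follows i j) (follows j i) ⟩
  follows j i ∨ follows i j ≡⟨ cycAdj≡follows j i ⟨
  cycAdj j i                ∎
  where open ≡-Reasoning

module CyclePermutationGraph (n : ℕ) (π : Permutation′ n) where

  G : Graph (n + n)
  G = cyclePermGraph n π

  v u : Fin n → Fin (n + n)
  v i = i ↑ˡ n
  u j = n ↑ʳ j

  data Vertex : Fin (n + n) → Set where
    first : ∀ i → Vertex (v i)
    second : ∀ j → Vertex (u j)

  vertex : ∀ w → Vertex w
  vertex w with splitAt n w | join-splitAt n n w
  ... | inj₁ i | refl = first i
  ... | inj₂ j | refl = second j

  v≢u : ∀ i j → v i ≢ u j
  v≢u i j e with trans (sym (splitAt-↑ˡ n i n)) (trans (cong (splitAt n) e) (splitAt-↑ʳ n n j))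
  ... | ()

  adj-vv : ∀ i j → adj G (v i) (v j) ≡ cycAdj i j
  adj-vv i j rewrite splitAt-↑ˡ n i n | splitAt-↑ˡ n j n = refl

  adj-uu : ∀ i j → adj G (u i) (u j) ≡ cycAdj i j
  adj-uu i j rewrite splitAt-↑ʳ n n i | splitAt-↑ʳ n n j = refl

  adj-vu : ∀ i j → adj G (v i) (u j) ≡ ⌊ (π ⟨$⟩ʳ i) Fin.≟ j ⌋
  adj-vu i j rewrite splitAt-↑ˡ n i n | splitAt-↑ʳ n n j = refl

  adj-uv : ∀ j i → adj G (u j) (v i) ≡ ⌊ (π ⟨$⟩ʳ i) Fin.≟ j ⌋
  adj-uv j i rewrite splitAt-↑ʳ n n j | splitAt-↑ˡ n i n = refl

  symmetric : Symmetric G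
  symmetric a b with splitAt n a | splitAt n b
  ... | inj₁ i | inj₁ j = cycAdj-sym i j
  ... | inj₂ i | inj₂ j = cycAdj-sym i j
  ... | inj₁ i | inj₂ j = refl
  ... | inj₂ i | inj₁ j = refl

  matched : ∀ j → adj G (u j) (v (π ⟨$⟩ˡ j)) ≡ true
  matched j rewrite adj-uv j (π ⟨$⟩ˡ j) | inverseʳ π {j} = ≟-refl j

  cubic : 3 ≤ n → Cubic G
  cubic n≥3 w with vertex w
  ... | first i = begin
    degree G (v i)                                           ≡⟨ sum-↑ n (𝟙 ∘ adj G (v i)) ⟩
    count (adj G (v i) ∘ v) + count (adj G (v i) ∘ u)        ≡⟨ cong₂ _+_ (count-cong (adj-vv i)) (count-cong (adj-vu i)) ⟩
    count (cycAdj i) + count (λ j → ⌊ (π ⟨$⟩ʳ i) Fin.≟ j ⌋)  ≡⟨ cong₂ _+_ (cycle-degree n≥3 i) one-partner ⟩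
    3                                                        ∎
    where
    open ≡-Reasoning
    one-partner : count (λ j → ⌊ (π ⟨$⟩ʳ i) Fin.≟ j ⌋) ≡ 1
    one-partner = count-unique _ (π ⟨$⟩ʳ i) (≟-refl _) (λ j e → sym (≟-sound e))
  ... | second j = begin
    degree G (u j)                                           ≡⟨ sum-↑ n (𝟙 ∘ adj G (u j)) ⟩
    count (adj G (u j) ∘ v) + count (adj G (u j) ∘ u)        ≡⟨ cong₂ _+_ (count-cong (adj-uv j)) (count-cong (adj-uu j)) ⟩
    count (λ i → ⌊ (π ⟨$⟩ʳ i) Fin.≟ j ⌋) + count (cycAdj j)  ≡⟨ cong₂ _+_ one-partner (cycle-degree n≥3 j) ⟩
    3                                                        ∎
    where
    open ≡-Reasoning
    one-partner : count (λ i → ⌊ (π ⟨$⟩ʳ i) Fin.≟ j ⌋) ≡ 1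
    one-partner = count-unique _ (π ⟨$⟩ˡ j) (trans (sym (adj-uv j (π ⟨$⟩ˡ j))) (matched j))
      (λ i e → trans (sym (inverseˡ π)) (cong (π ⟨$⟩ˡ_) (≟-sound e)))

odd : ℕ → Bool
odd 0 = false
odd 1 = true
odd (suc (suc k)) = odd k

odd-pred : ∀ k → odd (suc k) ≡ false → odd k ≡ true
odd-pred 0 ()
odd-pred 1 _ = refl
odd-pred (suc (suc k)) e = odd-pred k e

odds-below : ∀ m → count {m} (odd ∘ toℕ) ≡ ⌊ m /2⌋
odds-below 0 = refl
odds-below 1 = refl
odds-below (suc (suc m)) = cong suc (odds-below m)

-- First v 0 and the odd v i are
-- active at time 1, then every v i at time 2 (its two cycle neighbours are
-- odd or 0), and from u (π 0) the activation runs around the second cycle,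
-- each u j being helped by its active partner v (π⁻¹ j).
module Seeding (k : ℕ) (π : Permutation′ (2 + k)) (n≥3 : 3 ≤ 2 + k) where

  n : ℕ
  n = 2 + k

  open CyclePermutationGraph n π

  c : Fin n
  c = π ⟨$⟩ʳ Fin.zero

  seed : Fin (n + n) → Bool
  seed w = [ odd ∘ toℕ , (λ j → ⌊ j Fin.≟ c ⌋) ]′ (splitAt n w)

  seeds : Subset (n + n)
  seeds = tabulate (fromBool ∘ seed)

  seed-v : ∀ i → seed (v i) ≡ odd (toℕ i)
  seed-v i rewrite splitAt-↑ˡ n i n = refl

  seed-u : ∀ j → seed (u j) ≡ ⌊ j Fin.≟ c ⌋
  seed-u j rewrite splitAt-↑ʳ n n j = refl

  size : ∣ seeds ∣ ≡ ⌈ (n + 1) /2⌉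
  size = begin
    ∣ seeds ∣                                               ≡⟨ ∣tabulate∣ seed ⟩
    count seed                                              ≡⟨ sum-↑ n (𝟙 ∘ seed) ⟩
    count (seed ∘ v) + count (seed ∘ u)                     ≡⟨ cong₂ _+_ (count-cong seed-v) (count-cong seed-u) ⟩
    count {n} (odd ∘ toℕ) + count (λ j → ⌊ j Fin.≟ c ⌋)     ≡⟨ cong₂ _+_ (odds-below n) (count-unique _ c (≟-refl c) (λ _ → ≟-sound)) ⟩
    ⌊ n /2⌋ + 1                                             ≡⟨ +-comm ⌊ n /2⌋ 1 ⟩
    ⌈ suc n /2⌉                                             ≡⟨ cong ⌈_/2⌉ (+-comm 1 n) ⟩
    ⌈ (n + 1) /2⌉                                           ∎
    where open ≡-Reasoning

  open Activation G 2 using (activeAt-mono)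

  Active : ℕ → Fin (n + n) → Set
  Active t w = isIn (activeAt G 2 seeds t) w ≡ true

  stays : ∀ w s t → s ≤ t → Active s w → Active t w
  stays w s t = activeAt-mono seeds {s} {t} w

  seeded : ∀ w → seed w ≡ true → Active 0 w
  seeded w seed-w = trans (isIn-tabulate seed w) seed-w

  stage₁ : ∀ i → odd (toℕ i) ≡ true ⊎ toℕ i ≡ 0 → Active 1 (v i)
  stage₁ i (inj₁ odd-i) = stays (v i) 0 1 z≤n (seeded (v i) (trans (seed-v i) odd-i))
  stage₁ Fin.zero (inj₂ _) =
    activate-by-two G seeds (v Fin.zero) (v one) (u c) (v≢u one c)
      (trans (adj-vv Fin.zero one) (Follows⇒cycAdj 0→1))
      (trans (adj-vu Fin.zero c) (≟-refl c))
      (seeded (v one) (seed-v one))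
      (seeded (u c) (trans (seed-u c) (≟-refl c)))
    where
    one : Fin n
    one = Fin.suc Fin.zero
    0→1 : Follows Fin.zero one
    0→1 = succ refl

  -- Every v i is active at time 2: an even i ≠ 0 has an odd predecessor,
  -- and a successor that is odd or 0.
  stage₂ : ∀ i → Active 2 (v i)
  stage₂ Fin.zero = stays (v Fin.zero) 1 2 (s≤s z≤n) (stage₁ Fin.zero (inj₂ refl))
  stage₂ i@(Fin.suc y) with odd (toℕ i) in parity | successor i
  ... | true | _ = stays (v i) 1 2 (s≤s z≤n) (stage₁ i (inj₁ parity))
  ... | false | s , i→s =
    activate-by-two G (activeAt G 2 seeds 1) (v i) (v p) (v s) (p≢s ∘ ↑ˡ-injective n p s)
      (trans (adj-vv i p) (Follows⇒cycAdj⁻ p→i))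
      (trans (adj-vv i s) (Follows⇒cycAdj i→s))
      (stage₁ p (inj₁ (trans (cong odd (toℕ-inject₁ y)) (odd-pred (toℕ y) parity))))
      (stage₁ s (successor-early i→s))
    where
    p : Fin n
    p = Fin.inject₁ y
    p→i : Follows p i
    p→i = succ (cong suc (toℕ-inject₁ y))
    p≢s : p ≢ s
    p≢s p≡s = follows-asymmetric n≥3 p→i (subst (Follows i) (sym p≡s) i→s)
    successor-early : Follows i s → odd (toℕ s) ≡ true ⊎ toℕ s ≡ 0
    successor-early (succ e) = inj₁ (trans (cong odd (sym e)) (odd-pred (toℕ y) parity))
    successor-early (wrap _ s≡0) = inj₂ s≡0

  -- On the second cycle one active cycle neighbour suffices from time 2 on.
  module SecondCycle = CycleSpread (λ t j → Active (2 + t) (u j))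
    (λ {t} j → stays (u j) (2 + t) (3 + t) (n≤1+n (2 + t)))
    (λ {t} i j i~j uj-active →
      activate-by-two G (activeAt G 2 seeds (2 + t)) (u i) (u j) (v (π ⟨$⟩ˡ i))
        (v≢u (π ⟨$⟩ˡ i) j ∘ sym) (trans (adj-uu i j) i~j) (matched i) uj-active
        (stays (v (π ⟨$⟩ˡ i)) 2 (2 + t) (m≤m+n 2 t) (stage₂ (π ⟨$⟩ˡ i))))

  -- Everything is active at time 2 + 2n.  (The view is matched in a helper:
  -- abstracting the goal with `with` would unfold the activation process.)
  everyone : ∀ w → Active (2 + (n + n)) w
  everyone w = by-copy (vertex w)
    where
    start : Active 2 (u c)
    start = stays (u c) 0 2 z≤n (seeded (u c) (trans (seed-u c) (≟-refl c)))
    by-copy : ∀ {w} → Vertex w → Active (2 + (n + n)) w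
    by-copy (first i) = stays (v i) 2 (2 + (n + n)) (m≤m+n 2 (n + n)) (stage₂ i)
    by-copy (second j) = SecondCycle.all-active {0} c start j

  percolates : Percolates G 2 seeds
  percolates = 2 + (n + n) , all-in⇒⊤ (activeAt G 2 seeds (2 + (n + n))) everyone

half-bound : ∀ n s → n + n < 4 * s → ⌈ (n + 1) /2⌉ ≤ s
half-bound n s 2n<4s = begin
  ⌈ (n + 1) /2⌉ ≤⟨ ⌈n/2⌉-mono (subst (_≤ s + s) (+-comm 1 n) n<s+s) ⟩
  ⌈ (s + s) /2⌉ ≡⟨ n≡⌈n+n/2⌉ s ⟨
  s             ∎
  where
  open ≤-Reasoning
  four : ∀ s → (s + s) + (s + s) ≡ 4 * s
  four = solve-∀
  n<s+s : n < s + s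
  n<s+s = ≰⇒> (λ s+s≤n → <⇒≱ 2n<4s (subst (_≤ n + n) (four s) (+-mono-≤ s+s≤n s+s≤n)))

min-seed : ∀ k (π : Permutation′ (2 + k)) → 3 ≤ 2 + k →
  MinSeed (cyclePermGraph (2 + k) π) 2 ⌈ (2 + k + 1) /2⌉
min-seed k π n≥3 = (seeds , size , percolates) , minimal
  where
  open Seeding k π n≥3
  open CyclePermutationGraph (2 + k) π using (G; symmetric; cubic)
  minimal : ∀ S → Percolates G 2 S → ⌈ (2 + k + 1) /2⌉ ≤ ∣ S ∣
  minimal S perc = half-bound (2 + k) ∣ S ∣ (cubic-seed-bound G symmetric (cubic n≥3) S perc)

theorem2p3 : (n : ℕ) → 4 ≤ n → (π : Permutation′ n) →
    MinSeed (cyclePermGraph n π) 2 ⌈ (n + 1) /2⌉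
theorem2p3 (suc (suc k)) (s≤s (s≤s k≥2)) π = min-seed k π (s≤s (s≤s (≤-trans (s≤s z≤n) k≥2)))
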